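{- Every oriented path $P$ admits a DO-decomposition.
   Context: An oriented path $P=v_1\dots v_{\ell+1}$ has arcs $(v_iv_{i+1})$ each oriented forwards or backwards; its length is $\ell$ (a single vertex is the empty path). It is directed if all arcs have the same orientation; a block is a maximal directed subpath. $P$ is oscillating if each block has length at most $2$; an oscillating path is good if it has length at least $2$ and its last two arcs have opposite orientations. $\mathrm{rev}(P)$ is the path $v_{\ell+1}\dots v_1$ with the same arcs. A decomposition of $P$ is a sequence of paths $P_1,\dots,P_s$ whose concatenation (consecutive paths sharing the end/start vertex) is $P$. A decomposition $P_1P_2\dots P_{2k}=P^{d}_1P^{o}_1\dots P^{d}_kP^{o}_k$ is a DO-decomposition if: (E1) each path is nonempty except possibly $P^{d}_1$ and $P^{o}_k$; (E2) each $P^{d}_i$ is a directed path and each $P^{o}_i$ is an oscillating path, and if $P^{o}_i$ is nonempty then it is non-directed with at least two arcs; (E3) for each $i\in[k-1]$, both $P^{o}_i$ and $\mathrm{rev}(P^{o}_i)$ are good oscillating paths, and if the last two arcs of $P$ have opposite orientations then both $P^{o}_k$ and $\mathrm{rev}(P^{o}_k)$ are good; (E4) for each $i\in[2,2k-2]$, the last arc of $P_i$ and the first arc of $P_{i+1}$ have the same orientation in $P$. -}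

module Defs where

open import Data.Nat using (ℕ; zero; suc; _+_; _*_; _∸_; _≤_; _<_)
open import Data.List using (List; []; _∷_; _++_; map; reverse; concat; upTo; length; head; last)
open import Data.List.Relation.Unary.All using (All)
open import Data.Maybe using (just)
open import Data.Product using (Σ; ∃; _×_)
open import Data.Empty using (⊥)
open import Data.Unit using (⊤)
open import Relation.Nullary using (¬_)
open import Relation.Binary.PropositionalEquality using (_≡_; _≢_)

-- Orientation of an arc relative to the traversal direction v₁ → v_{ℓ+1}.
data Orient : Set where
  fwd bwd : Orient

flip : Orient → Orient
flip fwd = bwd
flip bwd = fwd

-- An oriented path v₁ … v_{ℓ+1} is recorded by the list of orientations of
-- its arcs (v_i v_{i+1}); the empty list is the empty path (a single vertex).
-- Concatenation of paths sharing an end/start vertex is list append.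
Path : Set
Path = List Orient

-- rev(P) = v_{ℓ+1} … v₁ with the same arcs: order reversed, each arc's
-- orientation relative to traversal flipped.
rev : Path → Path
rev P = reverse (map flip P)

Directed : Path → Set
Directed P = ∃ λ (d : Orient) → All (_≡ d) P

-- every block (maximal directed subpath) has length at most 2,
-- i.e. no three consecutive arcs with the same orientation
Oscillating : Path → Set
Oscillating (x ∷ y ∷ z ∷ r) = ¬ (x ≡ y × y ≡ z) × Oscillating (y ∷ z ∷ r)
Oscillating _ = ⊤

LastTwoOpposite : Path → Set
LastTwoOpposite (x ∷ y ∷ []) = x ≢ y
LastTwoOpposite (x ∷ y ∷ z ∷ r) = LastTwoOpposite (y ∷ z ∷ r)
LastTwoOpposite _ = ⊥

Good : Path → Set
Good P = Oscillating P × 2 ≤ length P × LastTwoOpposite P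

-- A decomposition P₁ … P_{2k} is given by k and Q : ℕ → Path with
-- Q j = P_{j+1} (0-based) for j < 2k; thus P^d_i = Q (2(i-1)), P^o_i = Q (2i-1).
record IsDODecomposition (P : Path) (k : ℕ) (Q : ℕ → Path) : Set where
  field
    k≥1    : 1 ≤ k
    concatenation : concat (map Q (upTo (2 * k))) ≡ P
    E1 : ∀ j → j < 2 * k → j ≢ 0 → j ≢ 2 * k ∸ 1 → Q j ≢ []
    E2-directed : ∀ i → i < k → Directed (Q (2 * i))
    E2-oscillating : ∀ i → i < k → Oscillating (Q (suc (2 * i)))
    E2-nonempty : ∀ i → i < k → Q (suc (2 * i)) ≢ [] →
                    ¬ Directed (Q (suc (2 * i))) × 2 ≤ length (Q (suc (2 * i)))
    E3-inner : ∀ i → suc i < k →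
                 Good (Q (suc (2 * i))) × Good (rev (Q (suc (2 * i))))
    E3-last : LastTwoOpposite P →
                 Good (Q (2 * k ∸ 1)) × Good (rev (Q (2 * k ∸ 1)))
    -- (E4): for paper indices i ∈ [2, 2k-2], i.e. 0-based j ∈ [1, 2k-3]
    E4 : ∀ j → 1 ≤ j → j + 3 ≤ 2 * k →
           ∃ λ (d : Orient) → last (Q j) ≡ just d × head (Q (suc j)) ≡ just d

DODecomposition : Path → Set
DODecomposition P = ∃ λ (k : ℕ) → ∃ λ (Q : ℕ → Path) → IsDODecomposition P k Q

{-# OPTIONS --safe #-}
-- The decomposition is built from the back, one arc at a time. Prepend an arc a
-- to a path x ∷ R that is already decomposed. If a = x, then a joins the first
-- directed piece D₁. Otherwise a starts a new first oscillating piece. If D₁ has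
-- at most one arc, a ∷ D₁ ++ O₁ is still oscillating, because every nonempty
-- oscillating piece we build starts with two opposite arcs. If D₁ has at least
-- two arcs, [a, x] becomes a new oscillating piece and the rest of D₁ becomes a
-- new directed piece. (E3) for the last piece needs no bookkeeping: if that piece
-- is empty, the path is directed or ends in a directed run of length ≥ 2, so its
-- last two arcs are not opposite.
module Submission where

open import Defs
open import Data.Nat using (ℕ; zero; suc; _+_; _*_; _∸_; _≤_; _<_; z≤n; s≤s)
open import Data.Nat.Properties using (*-suc; +-comm; ≤-pred; ≤-trans; ≤∧≢⇒<)
open import Data.List using (List; []; _∷_; _++_; map; reverse; concat; upTo; applyUpTo; length; head; last)
open import Data.List.Properties
  using (map-applyUpTo; reverse-++; reverse-involutive; length-reverse; length-map; ++-assoc; ++-identityʳ; length-++-≤ʳ)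
open import Data.List.Relation.Unary.All using ([]; _∷_)
open import Data.Maybe using (just)
open import Data.Product using (∃; _×_; _,_; proj₁; proj₂)
open import Data.Empty using (⊥; ⊥-elim)
open import Data.Unit using (tt)
open import Relation.Nullary using (¬_; Dec; yes; no)
open import Relation.Binary.PropositionalEquality
  using (_≡_; _≢_; refl; sym; trans; cong; subst; module ≡-Reasoning)

variable
  a x y d : Orient
  D O O′ X Y Z : Path
  Ps : List Path
  m n : ℕ

_≟_ : (a b : Orient) → Dec (a ≡ b)
fwd ≟ fwd = yes refl
fwd ≟ bwd = no λ ()
bwd ≟ fwd = no λ ()
bwd ≟ bwd = yes refl

flip-injective : flip a ≡ flip x → a ≡ x
flip-injective {fwd} {fwd} _ = refl
flip-injective {bwd} {bwd} _ = refl

FirstTwoOpposite : Path → Set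
FirstTwoOpposite (x ∷ y ∷ _) = x ≢ y
FirstTwoOpposite _ = ⊥

Aligned : Path → Path → Set
Aligned X Y = ∃ λ d → last X ≡ just d × head Y ≡ just d

GoodBothWays : Path → Set
GoodBothWays O = Good O × Good (rev O)

OscillatingPiece : Path → Set
OscillatingPiece O = Oscillating O × (O ≢ [] → FirstTwoOpposite O)

firstTwoOpposite⇒nonempty : FirstTwoOpposite O → O ≢ []
firstTwoOpposite⇒nonempty {[]} ()

firstTwoOpposite⇒2≤length : FirstTwoOpposite O → 2 ≤ length O
firstTwoOpposite⇒2≤length {_ ∷ _ ∷ _} _ = s≤s (s≤s z≤n)

firstTwoOpposite⇒¬directed : FirstTwoOpposite O → ¬ Directed O
firstTwoOpposite⇒¬directed {_ ∷ _ ∷ _} x≢y (_ , x≡d ∷ y≡d ∷ _) = x≢y (trans x≡d (sym y≡d))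

aligned⇒nonemptyʳ : Aligned X Y → Y ≢ []
aligned⇒nonemptyʳ (_ , _ , ()) refl

last-++ : ∀ X → last (X ++ y ∷ Z) ≡ last (y ∷ Z)
last-++ [] = refl
last-++ (_ ∷ []) = refl
last-++ (_ ∷ x ∷ X) = last-++ (x ∷ X)

aligned-++ˡ : ∀ X → Aligned O D → Aligned (X ++ O) D
aligned-++ˡ {O = _ ∷ _} X (d , lastO , headD) = d , trans (last-++ X) lastO , headD

oscillating-tail : Oscillating (x ∷ O) → Oscillating O
oscillating-tail {O = []} _ = tt
oscillating-tail {O = _ ∷ []} _ = tt
oscillating-tail {O = _ ∷ _ ∷ _} (_ , osc) = osc

∷-oscillating : FirstTwoOpposite (x ∷ O) → Oscillating O → Oscillating (x ∷ O)
∷-oscillating {O = _ ∷ []} _ _ = tt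
∷-oscillating {O = _ ∷ _ ∷ _} x≢y osc = (λ (x≡y , _) → x≢y x≡y) , osc

∷-oscillatingPiece : OscillatingPiece O → Oscillating (x ∷ O)
∷-oscillatingPiece {O = []} _ = tt
∷-oscillatingPiece {O = _ ∷ []} (_ , fto) = ⊥-elim (fto λ ())
∷-oscillatingPiece {O = _ ∷ _ ∷ _} (osc , fto) = (λ (_ , y≡z) → fto (λ ()) y≡z) , osc

-- The recursive definition of Oscillating is not visibly symmetric; this
-- window form is.
NoRunOfThree : Path → Set
NoRunOfThree P = ∀ as bs {x y z} → P ≡ as ++ x ∷ y ∷ z ∷ bs → ¬ (x ≡ y × y ≡ z)

oscillating⇒noRunOfThree : ∀ P → Oscillating P → NoRunOfThree P
oscillating⇒noRunOfThree _ osc [] _ refl = proj₁ osc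
oscillating⇒noRunOfThree _ osc (a ∷ as) bs refl =
  oscillating⇒noRunOfThree _ (oscillating-tail osc) as bs refl

noRunOfThree⇒oscillating : ∀ P → NoRunOfThree P → Oscillating P
noRunOfThree⇒oscillating [] _ = tt
noRunOfThree⇒oscillating (_ ∷ []) _ = tt
noRunOfThree⇒oscillating (_ ∷ _ ∷ []) _ = tt
noRunOfThree⇒oscillating (x ∷ y ∷ z ∷ P) noRun =
  noRun [] P refl ,
  noRunOfThree⇒oscillating (y ∷ z ∷ P) (λ as bs eq → noRun (x ∷ as) bs (cong (x ∷_) eq))

noRunOfThree-reverse : ∀ P → NoRunOfThree P → NoRunOfThree (reverse P)
noRunOfThree-reverse P noRun as bs {x} {y} {z} eq (x≡y , y≡z) =
  noRun (reverse bs) (reverse as) P≡ (sym y≡z , sym x≡y)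
  where
  open ≡-Reasoning
  P≡ : P ≡ reverse bs ++ z ∷ y ∷ x ∷ reverse as
  P≡ = begin
    P                                              ≡⟨ sym (reverse-involutive P) ⟩
    reverse (reverse P)                            ≡⟨ cong reverse eq ⟩
    reverse (as ++ x ∷ y ∷ z ∷ bs)                 ≡⟨ reverse-++ as (x ∷ y ∷ z ∷ bs) ⟩
    reverse (x ∷ y ∷ z ∷ bs) ++ reverse as         ≡⟨ cong (_++ reverse as) (reverse-++ (x ∷ y ∷ z ∷ []) bs) ⟩
    (reverse bs ++ z ∷ y ∷ x ∷ []) ++ reverse as   ≡⟨ ++-assoc (reverse bs) (z ∷ y ∷ x ∷ []) (reverse as) ⟩
    reverse bs ++ z ∷ y ∷ x ∷ reverse as           ∎

oscillating-map-flip : ∀ P → Oscillating P → Oscillating (map flip P)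
oscillating-map-flip [] _ = tt
oscillating-map-flip (_ ∷ []) _ = tt
oscillating-map-flip (_ ∷ _ ∷ []) _ = tt
oscillating-map-flip (x ∷ y ∷ z ∷ P) (¬run , osc) =
  (λ (x≡y , y≡z) → ¬run (flip-injective x≡y , flip-injective y≡z)) ,
  oscillating-map-flip (y ∷ z ∷ P) osc

oscillating-rev : ∀ P → Oscillating P → Oscillating (rev P)
oscillating-rev P osc =
  noRunOfThree⇒oscillating (rev P)
    (noRunOfThree-reverse (map flip P)
      (oscillating⇒noRunOfThree (map flip P) (oscillating-map-flip P osc)))

lastTwoOpposite⇒nonempty : LastTwoOpposite O → O ≢ []
lastTwoOpposite⇒nonempty {[]} ()

lastTwoOpposite-∷ : LastTwoOpposite O → LastTwoOpposite (x ∷ O)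
lastTwoOpposite-∷ {[]} ()
lastTwoOpposite-∷ {_ ∷ []} ()
lastTwoOpposite-∷ {_ ∷ _ ∷ _} lto = lto

lastTwoOpposite-∷⁻ : ∀ O → 2 ≤ length O → LastTwoOpposite (x ∷ O) → LastTwoOpposite O
lastTwoOpposite-∷⁻ (_ ∷ []) (s≤s ()) _
lastTwoOpposite-∷⁻ (_ ∷ _ ∷ _) _ lto = lto

lastTwoOpposite-++ : ∀ X → LastTwoOpposite O → LastTwoOpposite (X ++ O)
lastTwoOpposite-++ [] lto = lto
lastTwoOpposite-++ {O} (_ ∷ X) lto = lastTwoOpposite-∷ {X ++ O} (lastTwoOpposite-++ X lto)

lastTwoOpposite-++⁻ : ∀ X → 2 ≤ length O → LastTwoOpposite (X ++ O) → LastTwoOpposite O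
lastTwoOpposite-++⁻ [] _ lto = lto
lastTwoOpposite-++⁻ {O} (_ ∷ X) 2≤O lto =
  lastTwoOpposite-++⁻ X 2≤O (lastTwoOpposite-∷⁻ (X ++ O) (≤-trans 2≤O (length-++-≤ʳ O {X})) lto)

firstTwoOpposite⇒lastTwoOpposite-rev : FirstTwoOpposite O → LastTwoOpposite (rev O)
firstTwoOpposite⇒lastTwoOpposite-rev {x ∷ y ∷ O} x≢y =
  subst LastTwoOpposite (sym (reverse-++ (flip x ∷ flip y ∷ []) (map flip O)))
    (lastTwoOpposite-++ (reverse (map flip O)) (λ e → x≢y (sym (flip-injective e))))

directed⇒¬lastTwoOpposite : Directed O → ¬ LastTwoOpposite O
directed⇒¬lastTwoOpposite {_ ∷ _ ∷ []} (_ , x≡d ∷ y≡d ∷ []) x≢y = x≢y (trans x≡d (sym y≡d))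
directed⇒¬lastTwoOpposite {_ ∷ _ ∷ _ ∷ _} (d , _ ∷ dir) = directed⇒¬lastTwoOpposite (d , dir)

aligned-directed⇒¬lastTwoOpposite : ∀ O → last O ≡ just d → Directed (d ∷ D) → ¬ LastTwoOpposite (O ++ d ∷ D)
aligned-directed⇒¬lastTwoOpposite (_ ∷ []) refl (e , d≡e ∷ dir) =
  directed⇒¬lastTwoOpposite (e , d≡e ∷ d≡e ∷ dir)
aligned-directed⇒¬lastTwoOpposite (_ ∷ o ∷ []) = aligned-directed⇒¬lastTwoOpposite (o ∷ [])
aligned-directed⇒¬lastTwoOpposite (_ ∷ o ∷ o′ ∷ O) = aligned-directed⇒¬lastTwoOpposite (o ∷ o′ ∷ O)

goodBothWays : Oscillating O → FirstTwoOpposite O → LastTwoOpposite O → GoodBothWays O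
goodBothWays {O} osc fto lto =
  (osc , firstTwoOpposite⇒2≤length fto , lto) ,
  (oscillating-rev O osc , subst (2 ≤_) (sym length-rev) (firstTwoOpposite⇒2≤length fto) ,
   firstTwoOpposite⇒lastTwoOpposite-rev fto)
  where
  length-rev : length (rev O) ≡ length O
  length-rev = trans (length-reverse (map flip O)) (length-map flip O)

-- O ∷ Ps lists the pieces P^o_1, P^d_2, P^o_2, …, P^d_{m+1}, P^o_{m+1} that follow
-- P^d_1. Unlike (E2), the last oscillating piece must also start with two opposite
-- arcs when it is nonempty.
data DOTail : ℕ → Path → List Path → Set where
  end  : OscillatingPiece O → DOTail 0 O []
  link : Oscillating O → FirstTwoOpposite O → LastTwoOpposite O →
         Directed D → Aligned O D → (O′ ≢ [] → Aligned D O′) →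
         DOTail m O′ Ps → DOTail (suc m) O (D ∷ O′ ∷ Ps)

-- indexing with junk value [] out of range
_!_ : List Path → ℕ → Path
[] ! _ = []
(X ∷ _) ! zero = X
(_ ∷ Ps) ! suc n = Ps ! n

applyUpTo-! : ∀ Ps → applyUpTo (Ps !_) (length Ps) ≡ Ps
applyUpTo-! [] = refl
applyUpTo-! (X ∷ Ps) = cong (X ∷_) (applyUpTo-! Ps)

map-!-upTo : ∀ Ps → map (Ps !_) (upTo (length Ps)) ≡ Ps
map-!-upTo Ps = trans (map-applyUpTo (λ n → n) (Ps !_) (length Ps)) (applyUpTo-! Ps)

!-2*suc : ∀ O D Ps n → (O ∷ D ∷ Ps) ! (2 * suc n) ≡ Ps ! (2 * n)
!-2*suc O D Ps n = cong ((O ∷ D ∷ Ps) !_) (*-suc 2 n)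

2+≤2*suc⇒≤2* : 2 + n ≤ 2 * suc m → n ≤ 2 * m
2+≤2*suc⇒≤2* {n} {m} le = ≤-pred (≤-pred (subst (2 + n ≤_) (*-suc 2 m) le))

tail-length : DOTail m O Ps → length Ps ≡ 2 * m
tail-length (end _) = refl
tail-length {m = suc m} (link _ _ _ _ _ _ tail) = trans (cong (2 +_) (tail-length tail)) (sym (*-suc 2 m))

tail-piece : DOTail m O Ps → n ≤ m → OscillatingPiece ((O ∷ Ps) ! (2 * n))
tail-piece (end piece) z≤n = piece
tail-piece (link osc fto _ _ _ _ _) z≤n = osc , λ _ → fto
tail-piece {O = O} {n = suc n} (link {D = D} {O′ = O′} {Ps = Ps} _ _ _ _ _ _ tail) (s≤s n≤m) =
  subst OscillatingPiece (sym (!-2*suc O D (O′ ∷ Ps) n)) (tail-piece tail n≤m)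

head-piece : DOTail m O Ps → OscillatingPiece O
head-piece tail = tail-piece tail z≤n

tail-empty : DOTail m [] Ps → Ps ≡ []
tail-empty (end _) = refl
tail-empty (link _ () _ _ _ _ _)

tail-goodBothWays : DOTail m O Ps → n < m → GoodBothWays ((O ∷ Ps) ! (2 * n))
tail-goodBothWays (link osc fto lto _ _ _ _) (s≤s z≤n) = goodBothWays osc fto lto
tail-goodBothWays {O = O} {n = suc n} (link {D = D} {O′ = O′} {Ps = Ps} _ _ _ _ _ _ tail) (s≤s n<m) =
  subst GoodBothWays (sym (!-2*suc O D (O′ ∷ Ps) n)) (tail-goodBothWays tail n<m)

tail-directed : DOTail m O Ps → n < m → Directed ((X ∷ O ∷ Ps) ! (2 * suc n))
tail-directed {n = zero} (link _ _ _ dir _ _ _) _ = dir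
tail-directed {O = O} {n = suc n} {X = X} (link {D = D} {O′ = O′} {Ps = Ps} _ _ _ _ _ _ tail) (s≤s n<m) =
  subst Directed (sym (!-2*suc X O (D ∷ O′ ∷ Ps) (suc n))) (tail-directed {X = D} tail n<m)

tail-nonempty : DOTail m O Ps → n < 2 * m → (O ∷ Ps) ! n ≢ []
tail-nonempty {n = zero} (link _ fto _ _ _ _ _) _ = firstTwoOpposite⇒nonempty fto
tail-nonempty {O = O} {n = suc zero} (link _ _ _ _ O~D _ _) _ = aligned⇒nonemptyʳ {X = O} O~D
tail-nonempty {n = suc (suc n)} (link _ _ _ _ _ _ tail) lt = tail-nonempty tail (2+≤2*suc⇒≤2* lt)

tail-aligned : DOTail m O Ps → 2 + n ≤ 2 * m → Aligned ((O ∷ Ps) ! n) ((O ∷ Ps) ! suc n)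
tail-aligned {n = zero} (link _ _ _ _ O~D _ _) _ = O~D
tail-aligned {n = suc zero} (link _ _ _ _ _ D~O′ tail) le = D~O′ (tail-nonempty tail (2+≤2*suc⇒≤2* le))
tail-aligned {n = suc (suc n)} (link _ _ _ _ _ _ tail) le = tail-aligned tail (2+≤2*suc⇒≤2* le)

lastTwoOpposite-tail : ¬ LastTwoOpposite Z → DOTail m O Ps →
                       LastTwoOpposite (Z ++ O ++ concat Ps) → LastTwoOpposite (O ++ concat Ps)
lastTwoOpposite-tail {Z} {O = []} ¬lto tail lto with tail-empty tail
... | refl = ⊥-elim (¬lto (subst LastTwoOpposite (++-identityʳ Z) lto))
lastTwoOpposite-tail {O = _ ∷ []} _ tail _ = ⊥-elim (proj₂ (head-piece tail) (λ ()))
lastTwoOpposite-tail {Z} {O = _ ∷ _ ∷ _} _ _ lto = lastTwoOpposite-++⁻ Z (s≤s (s≤s z≤n)) lto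

tail-last-goodBothWays : DOTail m O Ps → LastTwoOpposite (O ++ concat Ps) → GoodBothWays ((O ∷ Ps) ! (2 * m))
tail-last-goodBothWays {O = O} (end (osc , fto)) lto =
  goodBothWays osc (fto (lastTwoOpposite⇒nonempty lto′)) lto′
  where
  lto′ : LastTwoOpposite O
  lto′ = subst LastTwoOpposite (++-identityʳ O) lto
tail-last-goodBothWays {m = suc m} {O = O} (link {D = d ∷ D} {O′ = O′} {Ps = Ps} _ _ _ dir (_ , lastO , refl) _ tail) lto =
  subst GoodBothWays (sym (!-2*suc O (d ∷ D) (O′ ∷ Ps) m)) (tail-last-goodBothWays tail
    (lastTwoOpposite-tail {Z = O ++ d ∷ D} (aligned-directed⇒¬lastTwoOpposite O lastO dir) tail
      (subst LastTwoOpposite (sym (++-assoc O (d ∷ D) (O′ ++ concat Ps))) lto)))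

isDODecomposition : Directed D → DOTail m O Ps →
                    IsDODecomposition (D ++ O ++ concat Ps) (suc m) ((D ∷ O ∷ Ps) !_)
isDODecomposition {D} {m} {O} {Ps} dir tail = record
  { k≥1 = s≤s z≤n
  ; concatenation = cong concat (subst (λ k → map Q (upTo k) ≡ D ∷ O ∷ Ps) length≡ (map-!-upTo (D ∷ O ∷ Ps)))
  ; E1 = λ where
      zero _ 0≢0 _ → ⊥-elim (0≢0 refl)
      (suc j) lt _ j≢last → tail-nonempty tail
        (≤∧≢⇒< (2+≤2*suc⇒≤2* lt) (λ j≡2m → j≢last (trans (cong suc j≡2m) (sym last≡))))
  ; E2-directed = λ where
      zero _ → dir
      (suc i) (s≤s i<m) → tail-directed {X = D} tail i<m
  ; E2-oscillating = λ i i<k → proj₁ (tail-piece tail (≤-pred i<k))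
  ; E2-nonempty = λ i i<k ne → let fto = proj₂ (tail-piece tail (≤-pred i<k)) ne in
      firstTwoOpposite⇒¬directed fto , firstTwoOpposite⇒2≤length fto
  ; E3-inner = λ i i<m → tail-goodBothWays tail (≤-pred i<m)
  ; E3-last = λ lto → subst GoodBothWays (cong Q (sym last≡))
      (tail-last-goodBothWays tail (lastTwoOpposite-tail {Z = D} (directed⇒¬lastTwoOpposite dir) tail lto))
  ; E4 = λ where
      (suc j) _ le → tail-aligned tail (2+≤2*suc⇒≤2* (subst (_≤ 2 * suc m) (cong suc (+-comm j 3)) le))
  }
  where
  Q : ℕ → Path
  Q = (D ∷ O ∷ Ps) !_
  length≡ : 2 + length Ps ≡ 2 * suc m
  length≡ = trans (cong (2 +_) (tail-length tail)) (sym (*-suc 2 m))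
  last≡ : 2 * suc m ∸ 1 ≡ suc (2 * m)
  last≡ = cong (_∸ 1) (*-suc 2 m)

data Decomposition (P : Path) : Set where
  decomposition : Directed D → DOTail m O Ps → (D ≢ [] → O ≢ [] → Aligned D O) →
                  D ++ O ++ concat Ps ≡ P → Decomposition P

directedDecomposition : Directed D → Decomposition D
directedDecomposition {D} dir =
  decomposition dir (end (tt , λ ne → ⊥-elim (ne refl))) (λ _ ne → ⊥-elim (ne refl)) (++-identityʳ D)

tailDecomposition : DOTail m O Ps → Decomposition (O ++ concat Ps)
tailDecomposition tail = decomposition (fwd , []) tail (λ ne → ⊥-elim (ne refl)) refl

prepend-tail : ∀ X → Oscillating (X ++ O) → FirstTwoOpposite (X ++ O) → DOTail m O Ps → DOTail m (X ++ O) Ps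
prepend-tail X osc fto (end _) = end (osc , λ _ → fto)
prepend-tail X osc fto (link _ _ lto dir O~D D~O′ tail) =
  link osc fto (lastTwoOpposite-++ X lto) dir (aligned-++ˡ X O~D) D~O′ tail

aligned-head : O ++ X ≡ a ∷ Z → O ≢ [] → Aligned (a ∷ []) O
aligned-head {[]} _ ne = ⊥-elim (ne refl)
aligned-head {o ∷ _} refl _ = o , refl , refl

prepend-same : Decomposition (a ∷ Z) → Decomposition (a ∷ a ∷ Z)
prepend-same {a} (decomposition {D = []} _ tail _ eq) =
  decomposition (a , refl ∷ []) tail (λ _ → aligned-head eq) (cong (a ∷_) eq)
prepend-same (decomposition {D = _ ∷ _} (d , a≡d ∷ dir) tail D~O refl) =
  decomposition (d , a≡d ∷ a≡d ∷ dir) tail (λ _ → D~O λ ()) refl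

prepend-opposite : a ≢ x → Decomposition (x ∷ Z) → Decomposition (a ∷ x ∷ Z)
prepend-opposite _ (decomposition {D = []} {O = []} _ tail _ eq) with tail-empty tail | eq
... | refl | ()
prepend-opposite a≢o (decomposition {D = []} {O = _ ∷ _} _ tail _ refl) =
  tailDecomposition (prepend-tail (_ ∷ []) (∷-oscillating a≢o (proj₁ (head-piece tail))) a≢o tail)
prepend-opposite a≢q (decomposition {D = _ ∷ []} _ tail _ refl) =
  tailDecomposition (prepend-tail (_ ∷ _ ∷ []) (∷-oscillating a≢q (∷-oscillatingPiece (head-piece tail))) a≢q tail)
prepend-opposite {a} a≢x (decomposition {D = x ∷ _ ∷ _} (_ , refl ∷ refl ∷ dir) tail D~O refl) =
  tailDecomposition (link {O = a ∷ x ∷ []} tt a≢x a≢x (x , refl ∷ dir) (x , refl , refl) (D~O λ ()) tail)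

prepend : ∀ a → Decomposition (x ∷ Z) → Decomposition (a ∷ x ∷ Z)
prepend {x} a dec with a ≟ x
... | yes refl = prepend-same dec
... | no a≢x = prepend-opposite a≢x dec

decompose : (P : Path) → Decomposition P
decompose [] = directedDecomposition (fwd , [])
decompose (a ∷ []) = directedDecomposition (a , refl ∷ [])
decompose (a ∷ x ∷ P) = prepend a (decompose (x ∷ P))

lemma5p8 : (P : Path) → DODecomposition P
lemma5p8 P with decompose P
... | decomposition {D = D} {m = m} {O = O} {Ps = Ps} dir tail _ refl =
  suc m , (D ∷ O ∷ Ps) !_ , isDODecomposition dir tail
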